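{- Let $M=(E,r)$ be a $q$-matroid and $A\le E$. Then $A$ is cyclic in $M$ if and only if $A$ is an open space of $M$. In particular, if $A$ is cyclic then $A=\sum C$, the sum over all circuits $C$ of $M$ with $C\le A$.
   Context: Let $q$ be a prime power and $E$ an $n$-dimensional $\mathbb{F}_q$-vector space. A $q$-matroid $(E,r)$ is a function $r$ from subspaces of $E$ to $\mathbb{Z}$ with (R1) $0\le r(A)\le\dim A$, (R2) $r(A)\le r(B)$ if $A\le B$, (R3) $r(A+B)+r(A\cap B)\le r(A)+r(B)$. A subspace $A$ is independent if $r(A)=\dim A$ and dependent otherwise; a circuit is a dependent subspace all of whose proper subspaces are independent; an open space is a (vector space) sum of circuits (the empty sum being the zero space). A subspace $A$ is cyclic if $r(B)=r(A)$ for every subspace $B\le A$ of codimension $1$ in $A$. -}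

module Defs where

open import Level using (0ℓ)
open import Data.Nat using (ℕ; zero; suc; _≤_; _^_; _+_)
open import Data.Nat.Primality using (Prime)
open import Data.Fin using (Fin)
open import Data.Vec using (Vec; []; _∷_; zipWith; map; replicate; foldr)
open import Data.Product using (Σ; _×_; ∃; _,_)
open import Data.List using (List; []; _∷_)
open import Data.List.Relation.Unary.All using (All)
open import Data.Vec.Relation.Unary.All renaming (All to VAll) using ()
open import Data.Empty using (⊥)
open import Relation.Nullary using (¬_; Dec)
open import Relation.Binary.PropositionalEquality using (_≡_; _≢_)
open import Algebra.Structures using (IsCommutativeRing)
open import Function.Bundles using (_↔_; _⇔_)

record FiniteField : Set₁ where
  field
    Carrier : Set
    _+F_ _*F_ : Carrier → Carrier → Carrier
    -F_ : Carrier → Carrier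
    0F 1F : Carrier
    isCommutativeRing : IsCommutativeRing _≡_ _+F_ _*F_ -F_ 0F 1F
    0≢1 : 0F ≢ 1F
    inv : (x : Carrier) → x ≢ 0F → Σ Carrier (λ y → x *F y ≡ 1F)
    q : ℕ
    p k : ℕ
    p-prime : Prime p
    q≡p^k : q ≡ p ^ suc k
    enumeration : Fin q ↔ Carrier

module LinAlg (F : FiniteField) (n : ℕ) where
  open FiniteField F

  V : Set
  V = Vec Carrier n

  _+V_ : V → V → V
  _+V_ = zipWith _+F_

  _·V_ : Carrier → V → V
  c ·V v = map (c *F_) v

  0V : V
  0V = replicate n 0F

  -- a subspace of E (membership is decidable; E is finite)
  record Subspace : Set₁ where
    field
      mem   : V → Set
      dec   : (v : V) → Dec (mem v)
      0∈    : mem 0V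
      +∈    : ∀ {u v} → mem u → mem v → mem (u +V v)
      ·∈    : ∀ c {v} → mem v → mem (c ·V v)
  open Subspace public

  _⊆_ : Subspace → Subspace → Set
  A ⊆ B = ∀ v → mem A v → mem B v

  _≐_ : Subspace → Subspace → Set
  A ≐ B = (A ⊆ B) × (B ⊆ A)

  IsSum : Subspace → Subspace → Subspace → Set
  IsSum S A B = ∀ v → mem S v ⇔ Σ V (λ a → Σ V (λ b → mem A a × mem B b × v ≡ a +V b))

  IsMeet : Subspace → Subspace → Subspace → Set
  IsMeet I A B = ∀ v → mem I v ⇔ (mem A v × mem B v)

  lincomb : ∀ {k} → Vec Carrier k → Vec V k → V
  lincomb []       []       = 0V
  lincomb (c ∷ cs) (b ∷ bs) = (c ·V b) +V lincomb cs bs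

  IsDim : Subspace → ℕ → Set
  IsDim A k = Σ (Vec V k) λ bs →
      VAll (mem A) bs
    × (∀ cs → lincomb cs bs ≡ 0V → cs ≡ replicate k 0F)
    × (∀ v → mem A v → Σ (Vec Carrier k) λ cs → lincomb cs bs ≡ v)

  InListSum : List Subspace → V → Set
  InListSum []       v = v ≡ 0V
  InListSum (C ∷ Cs) v =
    Σ V λ c → Σ V λ w → mem C c × InListSum Cs w × v ≡ c +V w

-- q-matroids on E = F_q^n (rank function with values in ℕ, so 0 ≤ r)

module _ (F : FiniteField) (n : ℕ) where
  open LinAlg F n

  record QMatroid : Set₁ where
    field
      r  : Subspace → ℕ
      R1 : ∀ A k → IsDim A k → r A ≤ k
      R2 : ∀ A B → A ⊆ B → r A ≤ r B
      R3 : ∀ A B S I → IsSum S A B → IsMeet I A B → r S + r I ≤ r A + r B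

module QMatroidNotions {F : FiniteField} {n : ℕ} (M : QMatroid F n) where
  open LinAlg F n
  open QMatroid M

  Independent : Subspace → Set
  Independent A = IsDim A (r A)

  Dependent : Subspace → Set
  Dependent A = ¬ Independent A

  Circuit : Subspace → Set₁
  Circuit C = Dependent C × (∀ B → B ⊆ C → ¬ (C ⊆ B) → Independent B)

  OpenSpace : Subspace → Set₁
  OpenSpace A = Σ (List Subspace) λ Cs → All Circuit Cs × (∀ v → mem A v ⇔ InListSum Cs v)

  Cyclic : Subspace → Set₁
  Cyclic A = ∀ B k → B ⊆ A → IsDim A (suc k) → IsDim B k → r B ≡ r A

  -- v lies in the sum of all circuits C of M with C ≤ A:
  -- v is a finite sum of vectors, each lying in some circuit contained in A
  InSumOfCircuitsIn : Subspace → V → Set₁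
  InSumOfCircuitsIn A v =
    Σ (List (Σ Subspace λ C → Circuit C × C ⊆ A × Σ V (mem C))) λ cs →
      sumV cs ≡ v
    where
      sumV : List (Σ Subspace λ C → Circuit C × C ⊆ A × Σ V (mem C)) → V
      sumV []                          = 0V
      sumV ((_ , _ , _ , (c , _)) ∷ cs) = c +V sumV cs

{-# OPTIONS --safe #-}
-- Open ⇒ cyclic: a hyperplane H of A = C₁ + ⋯ + Cₘ misses a vector x of some circuit C.
-- Then A = C + H, and C ∩ H is a proper, hence independent, subspace of C of codimension
-- at most one, so r C ≤ r (C ∩ H); submodularity for C and H gives r A ≤ r H.
-- Cyclic ⇒ open: while the sum T of the circuits collected so far is smaller than A, pick
-- x ∈ A ∖ T and a hyperplane H ⊇ T of A avoiding x. Cyclicity gives r H = r A, so an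
-- independent I ≤ H with dim I = r H spans with x a dependent subspace of A. A circuit
-- inside it is not contained in H, as its intersection with H lies in I; adding it to
-- the collection raises dim T, so the process ends with T = A.

module Submission where

open import Defs
open import Level using (0ℓ)
open import Algebra.Bundles using (AbelianGroup; CommutativeRing)
open import Algebra.Structures using (IsCommutativeRing; IsAbelianGroup)
import Algebra.Properties.AbelianGroup as AbelianGroupProperties
import Algebra.Properties.CommutativeSemigroup as CommutativeSemigroupProperties
import Algebra.Properties.Ring as RingProperties
open import Data.Empty using (⊥-elim)
open import Data.Fin using (Fin; zero; suc)
open import Data.Fin.Properties using (any?; *↔×; injective⇒≤)
import Data.Fin.Properties as Fin
open import Data.Nat using (ℕ; zero; suc; _≤_; _<_; _^_; _+_; z≤n; s≤s)
open import Data.Nat.Properties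
  using (≮⇒≥; <⇒≱; ^-monoʳ-<; ≤-trans; ≤-antisym; ≤-reflexive; <-irrefl; m≤m+n; m≤n+m;
         m≤n⇒m<n∨m≡n; +-mono-≤; +-monoˡ-≤; +-cancelˡ-≤; +-cancelʳ-≤;
         n≤0⇒n≡0; ≤-pred; ≤∧≢⇒<; ≤-<-trans; <-≤-trans; anyUpTo?; module ≤-Reasoning)
open import Data.Nat.Induction using (<-rec)
import Data.Nat.Properties as ℕₚ
open import Data.Product using (Σ; _×_; ∃; _,_; proj₁; proj₂; uncurry)
open import Data.Product.Function.NonDependent.Propositional using (_×-↔_)
open import Data.Sum using (_⊎_; inj₁; inj₂)
open import Data.List using (List; []; _∷_)
open import Data.List.Relation.Unary.All using ([]; _∷_) renaming (All to LAll)
import Data.List.Relation.Unary.All as LAll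
open import Data.Vec using (Vec; []; _∷_; zipWith; map; replicate; _++_; uncons; head; tail; splitAt)
open import Data.Vec.Relation.Unary.All using ([]; _∷_) renaming (All to VAll)
import Data.Vec.Relation.Unary.All as VAll
import Data.Vec.Relation.Unary.All.Properties as VAll
open import Data.Vec.Properties
  using (zipWith-assoc; zipWith-comm; zipWith-identityˡ; zipWith-identityʳ;
         zipWith-inverseˡ; zipWith-inverseʳ; map-∘; map-cong; map-id; map-const; map-replicate; ≡-dec; ++-injective)
open import Function using (_∘_; id)
open import Function.Bundles using (_↔_; _↣_; _⇔_; Inverse; Injection; Equivalence; mk↔ₛ′; mk↣; mk⇔)
open import Function.Definitions using (Injective)
open import Function.Properties.Inverse using (↔-sym; ↔-trans; ↔⇒↣)
open import Function.Properties.Injection using (↣-trans)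
open import Relation.Binary.Definitions using (DecidableEquality)
open import Relation.Binary.PropositionalEquality
open import Relation.Nullary using (¬_; Dec; yes; no)
open import Relation.Nullary.Decidable using (map′; via-injection; _×-dec_; ¬?; decidable-stable)
open import Relation.Unary using (Decidable)

module _ {X : Set} {m : ℕ} (enum : Fin m ↔ X) where
  open Inverse enum

  finite-any? : ∀ {p} {P : X → Set p} → Decidable P → Dec (∃ P)
  finite-any? {P = P} P? =
    map′ (λ (i , p) → to i , p) (λ (x , p) → from x , subst P (sym (strictlyInverseˡ x)) p)
         (any? (P? ∘ to))

  finite-≟ : DecidableEquality X
  finite-≟ = via-injection (↔⇒↣ (↔-sym enum)) Fin._≟_

vec-finite : ∀ {X : Set} {m} k → Fin m ↔ X → Fin (m ^ k) ↔ Vec X k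
vec-finite zero    _    = mk↔ₛ′ (λ _ → []) (λ _ → zero) (λ { [] → refl }) (λ { zero → refl })
vec-finite (suc k) enum = ↔-trans *↔× (↔-trans (enum ×-↔ vec-finite k enum) cons-↔)
  where
  cons-↔ : _ ↔ Vec _ (suc k)
  cons-↔ = mk↔ₛ′ (uncurry _∷_) uncons (λ { (x ∷ xs) → refl }) (λ _ → refl)

injective-vec-length≤ : ∀ {X : Set} {q a b} → 1 < q → Fin q ↔ X →
  (f : Vec X a → Vec X b) → Injective _≡_ _≡_ f → a ≤ b
injective-vec-length≤ {a = a} {b} 1<q enum f f-inj =
  ≮⇒≥ λ b<a → <⇒≱ (^-monoʳ-< _ 1<q b<a) (injective⇒≤ (Injection.injective counting))
  where
  counting : Fin (_ ^ a) ↣ Fin (_ ^ b)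
  counting = ↣-trans (↔⇒↣ (vec-finite a enum)) (↣-trans (mk↣ f-inj) (↔⇒↣ (↔-sym (vec-finite b enum))))

distinct⇒1<size : ∀ {m} {i j : Fin m} → i ≢ j → 1 < m
distinct⇒1<size {suc (suc _)} _                    = s≤s (s≤s z≤n)
distinct⇒1<size {suc zero}    {zero} {zero} 0≢0 = ⊥-elim (0≢0 refl)

bounded-extension : ∀ {a b} {X : Set} {R : Set b} (N : ℕ) (Q : ∀ {k} → Vec X k → Set a) →
  (∀ {k} {xs : Vec X k} → Q xs → k ≤ N) →
  (∀ {k} {xs : Vec X k} → Q xs → R ⊎ Σ X λ x → Q (x ∷ xs)) →
  ∀ {k} {xs : Vec X k} → Q xs → R
bounded-extension {X = X} {R} N Q bounded step {k} = go (suc N) (m≤n+m (suc N) k)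
  where
  go : ∀ fuel {k} {xs : Vec X k} → N < k + fuel → Q xs → R
  go zero    N<k q = ⊥-elim (<⇒≱ (subst (N <_) (ℕₚ.+-identityʳ _) N<k) (bounded q))
  go (suc f) N<k q with step q
  ... | inj₁ r        = r
  ... | inj₂ (_ , q′) = go f (subst (N <_) (ℕₚ.+-suc _ f) N<k) q′

module Coordinates (F : FiniteField) where
  open FiniteField F
  open IsCommutativeRing isCommutativeRing
    using (+-assoc; +-comm; +-identityˡ; +-identityʳ; -‿inverseˡ; -‿inverseʳ;
           *-assoc; *-comm; *-identityˡ; distribˡ; distribʳ; zeroˡ; zeroʳ)

  commutativeRing : CommutativeRing 0ℓ 0ℓ
  commutativeRing = record { isCommutativeRing = isCommutativeRing }

  carrier-≟ : DecidableEquality Carrier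
  carrier-≟ = finite-≟ enumeration

  1<q : 1 < q
  1<q = distinct⇒1<size {i = Inverse.from enumeration 0F} {Inverse.from enumeration 1F}
                        (0≢1 ∘ Injection.injective (↔⇒↣ (↔-sym enumeration)))

  infixl 6 _⊕_
  infixr 7 _⊙_

  _⊕_ : ∀ {m} → Vec Carrier m → Vec Carrier m → Vec Carrier m
  _⊕_ = zipWith _+F_

  ⊖_ : ∀ {m} → Vec Carrier m → Vec Carrier m
  ⊖_ = map -F_

  _⊙_ : ∀ {m} → Carrier → Vec Carrier m → Vec Carrier m
  c ⊙ u = map (c *F_) u

  𝟎 : ∀ {m} → Vec Carrier m
  𝟎 {m} = replicate m 0F

  ⊕-isAbelianGroup : ∀ m → IsAbelianGroup _≡_ (_⊕_ {m}) 𝟎 ⊖_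
  ⊕-isAbelianGroup m = record
    { isGroup = record
      { isMonoid = record
        { isSemigroup = record
          { isMagma = record { isEquivalence = isEquivalence ; ∙-cong = cong₂ _⊕_ }
          ; assoc   = zipWith-assoc +-assoc }
        ; identity = zipWith-identityˡ +-identityˡ , zipWith-identityʳ +-identityʳ }
      ; inverse = zipWith-inverseˡ -‿inverseˡ , zipWith-inverseʳ -‿inverseʳ
      ; ⁻¹-cong = cong ⊖_ }
    ; comm = zipWith-comm +-comm }

  ⊕-abelianGroup : ℕ → AbelianGroup 0ℓ 0ℓ
  ⊕-abelianGroup m = record { isAbelianGroup = ⊕-isAbelianGroup m }

  module ⊕ {m : ℕ} where
    open AbelianGroup (⊕-abelianGroup m) public
      using (assoc; comm; identityˡ; identityʳ; inverseʳ)
    open AbelianGroupProperties (⊕-abelianGroup m) public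
      using (inverseˡ-unique; x∙y⁻¹≈ε⇒x≈y; x≈z//y)
    open CommutativeSemigroupProperties (AbelianGroup.commutativeSemigroup (⊕-abelianGroup m)) public
      using (interchange)

  ⊙-distribˡ : ∀ {m} c (u v : Vec Carrier m) → c ⊙ (u ⊕ v) ≡ c ⊙ u ⊕ c ⊙ v
  ⊙-distribˡ c []      []      = refl
  ⊙-distribˡ c (a ∷ u) (b ∷ v) = cong₂ _∷_ (distribˡ c a b) (⊙-distribˡ c u v)

  ⊙-distribʳ : ∀ {m} c d (u : Vec Carrier m) → (c +F d) ⊙ u ≡ c ⊙ u ⊕ d ⊙ u
  ⊙-distribʳ c d []      = refl
  ⊙-distribʳ c d (a ∷ u) = cong₂ _∷_ (distribʳ a c d) (⊙-distribʳ c d u)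

  ⊙-assoc : ∀ {m} c d (u : Vec Carrier m) → c ⊙ d ⊙ u ≡ (c *F d) ⊙ u
  ⊙-assoc c d u = trans (sym (map-∘ _ _ u)) (map-cong (λ a → sym (*-assoc c d a)) u)

  ⊙-identity : ∀ {m} (u : Vec Carrier m) → 1F ⊙ u ≡ u
  ⊙-identity u = trans (map-cong *-identityˡ u) (map-id u)

  ⊙-zeroˡ : ∀ {m} (u : Vec Carrier m) → 0F ⊙ u ≡ 𝟎
  ⊙-zeroˡ u = trans (map-cong zeroˡ u) (map-const u 0F)

  ⊙-zeroʳ : ∀ {m} c → c ⊙ 𝟎 {m} ≡ 𝟎
  ⊙-zeroʳ {m} c = trans (map-replicate (c *F_) 0F m) (cong (replicate m) (zeroʳ c))

  ⊙-inverse : ∀ {m c c⁻¹} → c *F c⁻¹ ≡ 1F → (u : Vec Carrier m) → c⁻¹ ⊙ c ⊙ u ≡ u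
  ⊙-inverse {c = c} {c⁻¹} cc⁻¹≡1 u = begin
    c⁻¹ ⊙ c ⊙ u    ≡⟨ ⊙-assoc c⁻¹ c u ⟩
    (c⁻¹ *F c) ⊙ u ≡⟨ cong (_⊙ u) (trans (*-comm c⁻¹ c) cc⁻¹≡1) ⟩
    1F ⊙ u         ≡⟨ ⊙-identity u ⟩
    u              ∎
    where open ≡-Reasoning

  𝟎-++ : ∀ k {l} → 𝟎 {k + l} ≡ 𝟎 {k} ++ 𝟎 {l}
  𝟎-++ zero    = refl
  𝟎-++ (suc k) = cong (0F ∷_) (𝟎-++ k)

  ⊖≡-1⊙ : ∀ {m} (u : Vec Carrier m) → ⊖ u ≡ (-F 1F) ⊙ u
  ⊖≡-1⊙ u = map-cong (λ a → sym (RingProperties.-1*x≈-x (CommutativeRing.ring commutativeRing) a)) u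

module Linear (F : FiniteField) (n : ℕ) where
  open FiniteField F
  open LinAlg F n
  open Coordinates F
  open ≡-Reasoning

  LinearlyIndependent : ∀ {k} → Vec V k → Set
  LinearlyIndependent bs = ∀ cs → lincomb cs bs ≡ 0V → cs ≡ 𝟎

  InSpan : ∀ {k} → Vec V k → V → Set
  InSpan {k} bs v = Σ (Vec Carrier k) λ cs → lincomb cs bs ≡ v

  -- IsDim A k is definitionally Σ (Vec V k) (IsBasis A).
  IsBasis : Subspace → ∀ {k} → Vec V k → Set
  IsBasis A bs = VAll (mem A) bs × LinearlyIndependent bs × (∀ v → mem A v → InSpan bs v)

  _≟V_ : ∀ {m} → DecidableEquality (Vec Carrier m)
  _≟V_ = ≡-dec carrier-≟

  vectors-finite : ∀ k → Fin (q ^ k) ↔ Vec Carrier k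
  vectors-finite k = vec-finite k enumeration

  lincomb-𝟎 : ∀ {k} (bs : Vec V k) → lincomb 𝟎 bs ≡ 0V
  lincomb-𝟎 []       = refl
  lincomb-𝟎 (b ∷ bs) = trans (cong₂ _⊕_ (⊙-zeroˡ b) (lincomb-𝟎 bs)) (⊕.identityˡ 0V)

  lincomb-⊕ : ∀ {k} (cs ds : Vec Carrier k) bs →
              lincomb (cs ⊕ ds) bs ≡ lincomb cs bs ⊕ lincomb ds bs
  lincomb-⊕ []       []       []       = sym (⊕.identityˡ 0V)
  lincomb-⊕ (c ∷ cs) (d ∷ ds) (b ∷ bs) = begin
    (c +F d) ⊙ b ⊕ lincomb (cs ⊕ ds) bs
      ≡⟨ cong₂ _⊕_ (⊙-distribʳ c d b) (lincomb-⊕ cs ds bs) ⟩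
    (c ⊙ b ⊕ d ⊙ b) ⊕ (lincomb cs bs ⊕ lincomb ds bs)
      ≡⟨ ⊕.interchange _ _ _ _ ⟩
    (c ⊙ b ⊕ lincomb cs bs) ⊕ (d ⊙ b ⊕ lincomb ds bs) ∎

  lincomb-⊙ : ∀ {k} c (cs : Vec Carrier k) bs → lincomb (c ⊙ cs) bs ≡ c ⊙ lincomb cs bs
  lincomb-⊙ c []       []       = sym (⊙-zeroʳ c)
  lincomb-⊙ c (d ∷ cs) (b ∷ bs) = begin
    (c *F d) ⊙ b ⊕ lincomb (c ⊙ cs) bs ≡⟨ cong₂ _⊕_ (sym (⊙-assoc c d b)) (lincomb-⊙ c cs bs) ⟩
    c ⊙ d ⊙ b ⊕ c ⊙ lincomb cs bs      ≡⟨ ⊙-distribˡ c _ _ ⟨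
    c ⊙ (d ⊙ b ⊕ lincomb cs bs)        ∎

  lincomb-⊖ : ∀ {k} (cs : Vec Carrier k) bs → lincomb (⊖ cs) bs ≡ ⊖ lincomb cs bs
  lincomb-⊖ cs bs = begin
    lincomb (⊖ cs) bs          ≡⟨ cong (λ ds → lincomb ds bs) (⊖≡-1⊙ cs) ⟩
    lincomb ((-F 1F) ⊙ cs) bs  ≡⟨ lincomb-⊙ (-F 1F) cs bs ⟩
    (-F 1F) ⊙ lincomb cs bs    ≡⟨ ⊖≡-1⊙ _ ⟨
    ⊖ lincomb cs bs            ∎

  lincomb-++ : ∀ {k l} (cs : Vec Carrier k) (ds : Vec Carrier l) bs es →
               lincomb (cs ++ ds) (bs ++ es) ≡ lincomb cs bs ⊕ lincomb ds es
  lincomb-++ []       ds []       es = sym (⊕.identityˡ _)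
  lincomb-++ (c ∷ cs) ds (b ∷ bs) es =
    trans (cong (c ⊙ b ⊕_) (lincomb-++ cs ds bs es)) (sym (⊕.assoc _ _ _))

  lincomb-++-comm : ∀ {k l} (cs : Vec Carrier k) (ds : Vec Carrier l) bs es →
    lincomb (cs ++ ds) (bs ++ es) ≡ lincomb (ds ++ cs) (es ++ bs)
  lincomb-++-comm cs ds bs es = begin
    lincomb (cs ++ ds) (bs ++ es) ≡⟨ lincomb-++ cs ds bs es ⟩
    lincomb cs bs ⊕ lincomb ds es ≡⟨ ⊕.comm _ _ ⟩
    lincomb ds es ⊕ lincomb cs bs ≡⟨ lincomb-++ ds cs es bs ⟨
    lincomb (ds ++ cs) (es ++ bs) ∎

  lincomb-injective : ∀ {k} {bs : Vec V k} → LinearlyIndependent bs →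
                      Injective _≡_ _≡_ (λ cs → lincomb cs bs)
  lincomb-injective {bs = bs} ind {cs} {ds} eq = ⊕.x∙y⁻¹≈ε⇒x≈y cs ds (ind _ (begin
    lincomb (cs ⊕ ⊖ ds) bs            ≡⟨ lincomb-⊕ cs (⊖ ds) bs ⟩
    lincomb cs bs ⊕ lincomb (⊖ ds) bs ≡⟨ cong₂ _⊕_ eq (lincomb-⊖ ds bs) ⟩
    lincomb ds bs ⊕ ⊖ lincomb ds bs   ≡⟨ ⊕.inverseʳ _ ⟩
    0V                                ∎))

  lincomb-∈ : ∀ {k} (A : Subspace) {bs : Vec V k} → VAll (mem A) bs → ∀ cs → mem A (lincomb cs bs)
  lincomb-∈ A []         []       = 0∈ A
  lincomb-∈ A (b∈ ∷ bs∈) (c ∷ cs) = +∈ A (·∈ A c b∈) (lincomb-∈ A bs∈ cs)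

  span : ∀ {k} → Vec V k → Subspace
  span {k} bs = record
    { mem = InSpan bs
    ; dec = λ v → finite-any? (vectors-finite k) (λ cs → lincomb cs bs ≟V v)
    ; 0∈  = 𝟎 , lincomb-𝟎 bs
    ; +∈  = λ (cs , eq) (ds , eq′) → cs ⊕ ds , trans (lincomb-⊕ cs ds bs) (cong₂ _⊕_ eq eq′)
    ; ·∈  = λ c (cs , eq) → c ⊙ cs , trans (lincomb-⊙ c cs bs) (cong (c ⊙_) eq) }

  span-⊆ : ∀ {k} (A : Subspace) {bs : Vec V k} → VAll (mem A) bs → span bs ⊆ A
  span-⊆ A bs∈ v (cs , eq) = subst (mem A) eq (lincomb-∈ A bs∈ cs)

  span-generators : ∀ {k} (bs : Vec V k) → VAll (InSpan bs) bs
  span-generators []       = []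
  span-generators (b ∷ bs) =
    (1F ∷ 𝟎 , trans (cong₂ _⊕_ (⊙-identity b) (lincomb-𝟎 bs)) (⊕.identityʳ b))
    ∷ VAll.map (λ (cs , eq) → 0F ∷ cs , trans (cong₂ _⊕_ (⊙-zeroˡ b) eq) (⊕.identityˡ _))
               (span-generators bs)

  span-basis : ∀ {k} {bs : Vec V k} → LinearlyIndependent bs → IsBasis (span bs) bs
  span-basis {bs = bs} ind = span-generators bs , ind , λ _ v∈ → v∈

  span-⊆-∷ : ∀ {k} v (bs : Vec V k) → span bs ⊆ span (v ∷ bs)
  span-⊆-∷ v bs = span-⊆ (span (v ∷ bs)) (VAll.tail (span-generators (v ∷ bs)))

  span-∷-absorb : ∀ {k} {v} {bs : Vec V k} → InSpan bs v → span (v ∷ bs) ⊆ span bs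
  span-∷-absorb {bs = bs} v∈ = span-⊆ (span bs) (v∈ ∷ span-generators bs)

  span-⊆-++ˡ : ∀ {k l} (bs : Vec V k) (es : Vec V l) → span bs ⊆ span (bs ++ es)
  span-⊆-++ˡ bs es = span-⊆ (span (bs ++ es)) (VAll.++ˡ⁻ bs (span-generators (bs ++ es)))

  span-⊆-++ʳ : ∀ {k l} (bs : Vec V k) (es : Vec V l) → span es ⊆ span (bs ++ es)
  span-⊆-++ʳ bs es = span-⊆ (span (bs ++ es)) (VAll.++ʳ⁻ bs (span-generators (bs ++ es)))

  ⊖-∈ : ∀ A {u} → mem A u → mem A (⊖ u)
  ⊖-∈ A {u} u∈A = subst (mem A) (sym (⊖≡-1⊙ u)) (·∈ A (-F 1F) u∈A)

  ⊙-∈-cancel : ∀ A {c u} → c ≢ 0F → mem A (c ⊙ u) → mem A u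
  ⊙-∈-cancel A {c} {u} c≢0 cu∈A with inv c c≢0
  ... | c⁻¹ , cc⁻¹≡1 = subst (mem A) (⊙-inverse cc⁻¹≡1 u) (·∈ A c⁻¹ cu∈A)

  ⊆-or-witness : (A B : Subspace) → A ⊆ B ⊎ Σ V λ x → mem A x × ¬ mem B x
  ⊆-or-witness A B with finite-any? (vectors-finite n) (λ x → dec A x ×-dec ¬? (dec B x))
  ... | yes witness = inj₂ witness
  ... | no ¬witness = inj₁ λ x x∈A → decidable-stable (dec B x) λ x∉B → ¬witness (x , x∈A , x∉B)

  independent⇒length≤n : ∀ {k} {bs : Vec V k} → LinearlyIndependent bs → k ≤ n
  independent⇒length≤n ind = injective-vec-length≤ 1<q enumeration _ (lincomb-injective ind)

  independent⇒length≤spanning : ∀ {k d} {bs : Vec V k} (L : Vec V d) →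
    LinearlyIndependent bs → VAll (InSpan L) bs → k ≤ d
  independent⇒length≤spanning {bs = bs} L ind bs⊆L =
    injective-vec-length≤ 1<q enumeration (proj₁ ∘ coordsInL) coordsInL-injective
    where
    coordsInL : ∀ cs → InSpan L (lincomb cs bs)
    coordsInL = lincomb-∈ (span L) bs⊆L
    coordsInL-injective : Injective _≡_ _≡_ (proj₁ ∘ coordsInL)
    coordsInL-injective {cs} {ds} eq = lincomb-injective ind (begin
      lincomb cs bs                    ≡⟨ proj₂ (coordsInL cs) ⟨
      lincomb (proj₁ (coordsInL cs)) L ≡⟨ cong (λ es → lincomb es L) eq ⟩
      lincomb (proj₁ (coordsInL ds)) L ≡⟨ proj₂ (coordsInL ds) ⟩
      lincomb ds bs                    ∎)

  independent⇒length≤dim : ∀ {A d k} {bs : Vec V k} → IsDim A d →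
    VAll (mem A) bs → LinearlyIndependent bs → k ≤ d
  independent⇒length≤dim (basis , _ , _ , spans) bs∈A ind =
    independent⇒length≤spanning basis ind (VAll.map (spans _) bs∈A)

  dim-unique : ∀ {A j k} → IsDim A j → IsDim A k → j ≡ k
  dim-unique {A} dj@(bj , bj∈ , indj , _) dk@(bk , bk∈ , indk , _) =
    ≤-antisym (independent⇒length≤dim {A} dk bj∈ indj) (independent⇒length≤dim {A} dj bk∈ indk)

  independent-∷ : ∀ {k} {bs : Vec V k} {v} → LinearlyIndependent bs → ¬ InSpan bs v →
                  LinearlyIndependent (v ∷ bs)
  independent-∷ {bs = bs} {v} ind v∉ (c ∷ cs) eq with carrier-≟ c 0F
  ... | yes refl = cong (0F ∷_) (ind cs (begin
    lincomb cs bs          ≡⟨ ⊕.identityˡ _ ⟨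
    0V ⊕ lincomb cs bs     ≡⟨ cong (_⊕ _) (⊙-zeroˡ v) ⟨
    0F ⊙ v ⊕ lincomb cs bs ≡⟨ eq ⟩
    0V                     ∎))
  ... | no c≢0 = ⊥-elim (v∉ (⊙-∈-cancel (span bs) c≢0 cv∈bs))
    where
    cv∈bs : InSpan bs (c ⊙ v)
    cv∈bs = subst (InSpan bs) (sym (⊕.inverseˡ-unique _ _ eq)) (⊖-∈ (span bs) (cs , refl))

  independent-∷⇒∉span : ∀ {k} {bs : Vec V k} {v} → LinearlyIndependent (v ∷ bs) → ¬ InSpan bs v
  independent-∷⇒∉span {bs = bs} {v} ind (cs , eq) = 0≢1 (sym (cong head (ind (1F ∷ ⊖ cs) (begin
    1F ⊙ v ⊕ lincomb (⊖ cs) bs ≡⟨ cong₂ _⊕_ (⊙-identity v) (lincomb-⊖ cs bs) ⟩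
    v ⊕ ⊖ lincomb cs bs        ≡⟨ cong (λ w → v ⊕ ⊖ w) eq ⟩
    v ⊕ ⊖ v                    ≡⟨ ⊕.inverseʳ v ⟩
    0V                         ∎))))

  independent-tail : ∀ {k} {bs : Vec V k} {v} → LinearlyIndependent (v ∷ bs) → LinearlyIndependent bs
  independent-tail {v = v} ind cs eq =
    cong tail (ind (0F ∷ cs) (trans (cong₂ _⊕_ (⊙-zeroˡ v) eq) (⊕.identityˡ 0V)))

  independent-++-comm : ∀ {k l} {bs : Vec V k} {es : Vec V l} →
    LinearlyIndependent (bs ++ es) → LinearlyIndependent (es ++ bs)
  independent-++-comm {k} {l} {bs} {es} ind dcs eq with splitAt l dcs
  ... | ds , cs , refl
    with ++-injective cs 𝟎 (trans (ind (cs ++ ds) (trans (lincomb-++-comm cs ds bs es) eq)) (𝟎-++ k))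
  ... | refl , refl = sym (𝟎-++ l)

  inSpan-++-comm : ∀ {k l} {bs : Vec V k} {es : Vec V l} {v} → InSpan (bs ++ es) v → InSpan (es ++ bs) v
  inSpan-++-comm {k} {bs = bs} {es} (cds , eq) with splitAt k cds
  ... | cs , ds , refl = ds ++ cs , trans (sym (lincomb-++-comm cs ds bs es)) eq

  basis-++-comm : ∀ {A k l} {bs : Vec V k} {es : Vec V l} → IsBasis A (bs ++ es) → IsBasis A (es ++ bs)
  basis-++-comm {bs = bs} {es} (∈A , ind , spans) =
    VAll.++⁺ (VAll.++ʳ⁻ bs ∈A) (VAll.++ˡ⁻ bs ∈A) , independent-++-comm {bs = bs} ind ,
    λ v v∈A → inSpan-++-comm {bs = bs} {es} (spans v v∈A)

  independent-spans : ∀ {A d} {bs : Vec V d} → IsDim A d → VAll (mem A) bs →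
    LinearlyIndependent bs → A ⊆ span bs
  independent-spans {A} {bs = bs} dA bs∈A ind with ⊆-or-witness A (span bs)
  ... | inj₁ A⊆ = A⊆
  ... | inj₂ (v , v∈A , v∉) =
    ⊥-elim (<-irrefl refl (independent⇒length≤dim {A} dA (v∈A ∷ bs∈A) (independent-∷ ind v∉)))

  proper-subspace-dim< : ∀ {W Z w d} → W ⊆ Z → ¬ (Z ⊆ W) → IsDim Z d → IsDim W w → w < d
  proper-subspace-dim< {W} {Z} W⊆Z Z⊈W dZ (ω , ω∈W , ind , _)
    with m≤n⇒m<n∨m≡n (independent⇒length≤dim {Z} dZ (VAll.map (W⊆Z _) ω∈W) ind)
  ... | inj₁ w<d  = w<d
  ... | inj₂ refl = ⊥-elim (Z⊈W λ v v∈Z →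
    span-⊆ W ω∈W v (independent-spans {Z} dZ (VAll.map (W⊆Z _) ω∈W) ind v v∈Z))

  extend-to-basis : ∀ {A k} {bs : Vec V k} → VAll (mem A) bs → LinearlyIndependent bs →
    Σ ℕ λ m → Σ (Vec V m) λ ρ → IsBasis A (ρ ++ bs)
  extend-to-basis {A} {k} {bs} bs∈A ind = bounded-extension n Extension bounded grow ([] , ind)
    where
    Extension : ∀ {m} → Vec V m → Set
    Extension ρ = VAll (mem A) ρ × LinearlyIndependent (ρ ++ bs)
    bounded : ∀ {m} {ρ : Vec V m} → Extension ρ → m ≤ n
    bounded {m} (_ , ind′) = ≤-trans (m≤m+n m k) (independent⇒length≤n ind′)
    grow : ∀ {m} {ρ : Vec V m} → Extension ρ →
           (Σ ℕ λ m → Σ (Vec V m) λ ρ → IsBasis A (ρ ++ bs)) ⊎ Σ V λ v → Extension (v ∷ ρ)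
    grow {ρ = ρ} (ρ∈A , ind′) with ⊆-or-witness A (span (ρ ++ bs))
    ... | inj₁ spans          = inj₁ (_ , ρ , VAll.++⁺ ρ∈A bs∈A , ind′ , spans)
    ... | inj₂ (v , v∈A , v∉) = inj₂ (v , v∈A ∷ ρ∈A , independent-∷ ind′ v∉)

  dimension : (A : Subspace) → Σ ℕ (IsDim A)
  dimension A with extend-to-basis {A} {bs = []} [] (λ { [] _ → refl })
  ... | m , ρ , basis = m + 0 , ρ ++ [] , basis

  infixr 30 _⊞_ _⊓_

  _⊞_ : Subspace → Subspace → Subspace
  A ⊞ B = record
    { mem = λ v → Σ V λ a → Σ V λ b → mem A a × mem B b × v ≡ a ⊕ b
    ; dec = λ v → ∃V? λ a → ∃V? λ b → dec A a ×-dec dec B b ×-dec (v ≟V (a ⊕ b))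
    ; 0∈  = 0V , 0V , 0∈ A , 0∈ B , sym (⊕.identityˡ 0V)
    ; +∈  = λ (a , b , a∈ , b∈ , eq) (a′ , b′ , a′∈ , b′∈ , eq′) →
              a ⊕ a′ , b ⊕ b′ , +∈ A a∈ a′∈ , +∈ B b∈ b′∈ ,
              trans (cong₂ _⊕_ eq eq′) (⊕.interchange a b a′ b′)
    ; ·∈  = λ c (a , b , a∈ , b∈ , eq) →
              c ⊙ a , c ⊙ b , ·∈ A c a∈ , ·∈ B c b∈ , trans (cong (c ⊙_) eq) (⊙-distribˡ c a b) }
    where
    ∃V? : ∀ {P : V → Set} → Decidable P → Dec (∃ P)
    ∃V? = finite-any? (vectors-finite n)

  _⊓_ : Subspace → Subspace → Subspace
  A ⊓ B = record
    { mem = λ v → mem A v × mem B v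
    ; dec = λ v → dec A v ×-dec dec B v
    ; 0∈  = 0∈ A , 0∈ B
    ; +∈  = λ (a∈ , b∈) (a′∈ , b′∈) → +∈ A a∈ a′∈ , +∈ B b∈ b′∈
    ; ·∈  = λ c (a∈ , b∈) → ·∈ A c a∈ , ·∈ B c b∈ }

  ⊞-isSum : ∀ A B → IsSum (A ⊞ B) A B
  ⊞-isSum A B v = mk⇔ id id

  ⊓-isMeet : ∀ A B → IsMeet (A ⊓ B) A B
  ⊓-isMeet A B v = mk⇔ id id

  ⊆-⊞ˡ : ∀ {A B} → A ⊆ A ⊞ B
  ⊆-⊞ˡ {B = B} v v∈A = v , 0V , v∈A , 0∈ B , sym (⊕.identityʳ v)

  ⊆-⊞ʳ : ∀ {A B} → B ⊆ A ⊞ B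
  ⊆-⊞ʳ {A} v v∈B = 0V , v , 0∈ A , v∈B , sym (⊕.identityˡ v)

  ⊞-⊆ : ∀ {A B C} → A ⊆ C → B ⊆ C → A ⊞ B ⊆ C
  ⊞-⊆ {C = C} A⊆C B⊆C v (a , b , a∈A , b∈B , eq) =
    subst (mem C) (sym eq) (+∈ C (A⊆C a a∈A) (B⊆C b b∈B))

  ⊞-mono : ∀ {A A′ B B′} → A ⊆ A′ → B ⊆ B′ → A ⊞ B ⊆ A′ ⊞ B′
  ⊞-mono A⊆ B⊆ v (a , b , a∈ , b∈ , eq) = a , b , A⊆ a a∈ , B⊆ b b∈ , eq

  modular : ∀ {A B C} → A ⊆ C → C ⊓ (A ⊞ B) ⊆ A ⊞ (C ⊓ B)
  modular {C = C} A⊆C v (v∈C , a , b , a∈A , b∈B , eq) = a , b , a∈A , (b∈C , b∈B) , eq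
    where
    b∈C : mem C b
    b∈C = subst (mem C) (sym (⊕.x≈z//y b a v (trans (⊕.comm b a) (sym eq))))
                (+∈ C v∈C (⊖-∈ C (A⊆C a a∈A)))

  span-++ : ∀ {k l} (bs : Vec V k) (es : Vec V l) → span (bs ++ es) ⊆ span bs ⊞ span es
  span-++ {k} bs es v (cds , eq) with splitAt k cds
  ... | cs , ds , refl =
    lincomb cs bs , lincomb ds es , (cs , refl) , (ds , refl) , trans (sym eq) (lincomb-++ cs ds bs es)

  span-∷-⊓ : ∀ {H x k} {bs : Vec V k} → VAll (mem H) bs → ¬ mem H x → H ⊓ span (x ∷ bs) ⊆ span bs
  span-∷-⊓ {H} {x} {bs = bs} bs∈H x∉H v (v∈H , c ∷ cs , eq) with carrier-≟ c 0F
  ... | yes refl = cs , (begin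
    lincomb cs bs          ≡⟨ ⊕.identityˡ _ ⟨
    0V ⊕ lincomb cs bs     ≡⟨ cong (_⊕ _) (⊙-zeroˡ x) ⟨
    0F ⊙ x ⊕ lincomb cs bs ≡⟨ eq ⟩
    v                      ∎)
  ... | no c≢0 = ⊥-elim (x∉H (⊙-∈-cancel H c≢0 cx∈H))
    where
    cx∈H : mem H (c ⊙ x)
    cx∈H = subst (mem H) (sym (⊕.x≈z//y (c ⊙ x) _ v eq)) (+∈ H v∈H (⊖-∈ H (lincomb-∈ H bs∈H cs)))

  IsHyperplane : Subspace → Subspace → Set
  IsHyperplane H A = H ⊆ A × Σ ℕ λ d → IsDim A (suc d) × IsDim H d

  hyperplane-⊞ : ∀ {H A x} → IsHyperplane H A → mem A x → ¬ mem H x → A ⊆ span (x ∷ []) ⊞ H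
  hyperplane-⊞ {H} {A} {x} (H⊆A , _ , dA , β , β∈H , indβ , _) x∈A x∉H v v∈A =
    ⊞-mono {span (x ∷ [])} {span (x ∷ [])} {span β} {H} (λ _ → id) (span-⊆ H β∈H) v
      (span-++ (x ∷ []) β v (A⊆xβ v v∈A))
    where
    A⊆xβ : A ⊆ span (x ∷ β)
    A⊆xβ = independent-spans {A} dA (x∈A ∷ VAll.map (H⊆A _) β∈H)
             (independent-∷ indβ (x∉H ∘ span-⊆ H β∈H _))

  hyperplane-avoiding : ∀ {T A x} → T ⊆ A → mem A x → ¬ mem T x →
    Σ Subspace λ H → IsHyperplane H A × T ⊆ H × ¬ mem H x
  hyperplane-avoiding {T} {A} {x} T⊆A x∈A x∉T with dimension T
  ... | _ , τ , τ∈T , indτ , T⊆τ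
    with extend-to-basis {A} (x∈A ∷ VAll.map (T⊆A _) τ∈T) (independent-∷ indτ (x∉T ∘ span-⊆ T τ∈T _))
  ... | _ , ρ , ρxτ-basis with basis-++-comm {A} {bs = ρ} {es = x ∷ τ} ρxτ-basis
  ... | xτρ-basis@(xτρ∈A , ind , _) =
    span (τ ++ ρ) ,
    (span-⊆ A (VAll.tail xτρ∈A) , _ , (_ , xτρ-basis) , (_ , span-basis (independent-tail ind))) ,
    (λ v v∈T → span-⊆-++ˡ τ ρ v (T⊆τ v v∈T)) ,
    independent-∷⇒∉span ind

module Rank {F : FiniteField} {n : ℕ} (M : QMatroid F n) where
  open FiniteField F
  open LinAlg F n
  open Coordinates F
  open Linear F n
  open QMatroid M
  open QMatroidNotions M
  open ≤-Reasoning

  rank-cong : ∀ {A B} → A ⊆ B → B ⊆ A → r A ≡ r B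
  rank-cong A⊆B B⊆A = ≤-antisym (R2 _ _ A⊆B) (R2 _ _ B⊆A)

  rank-submodular : ∀ A B → r (A ⊞ B) + r (A ⊓ B) ≤ r A + r B
  rank-submodular A B = R3 A B (A ⊞ B) (A ⊓ B) (⊞-isSum A B) (⊓-isMeet A B)

  rank-subadditive : ∀ A B → r (A ⊞ B) ≤ r A + r B
  rank-subadditive A B = ≤-trans (m≤m+n _ _) (rank-submodular A B)

  rank-span≤ : ∀ {k} (bs : Vec V k) → r (span bs) ≤ k
  rank-span≤ bs with dimension (span bs)
  ... | e , dS@(basis , basis∈S , ind , _) =
    ≤-trans (R1 (span bs) e dS) (independent⇒length≤spanning bs ind basis∈S)

  rank-∷≤ : ∀ {k} v (bs : Vec V k) → r (span (v ∷ bs)) ≤ suc (r (span bs))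
  rank-∷≤ v bs = begin
    r (span (v ∷ bs))                 ≤⟨ R2 _ _ (span-++ (v ∷ []) bs) ⟩
    r (span (v ∷ []) ⊞ span bs)       ≤⟨ rank-subadditive _ _ ⟩
    r (span (v ∷ [])) + r (span bs)   ≤⟨ +-monoˡ-≤ _ (rank-span≤ (v ∷ [])) ⟩
    suc (r (span bs))                 ∎

  independent-cong : ∀ {A B} → A ⊆ B → B ⊆ A → Independent A → Independent B
  independent-cong {A} {B} A⊆B B⊆A (bs , bs∈A , ind , spans) =
    subst (IsDim B) (rank-cong A⊆B B⊆A) (bs , VAll.map (A⊆B _) bs∈A , ind , λ v v∈B → spans v (B⊆A v v∈B))

  independent? : ∀ A → Dec (Independent A)
  independent? A with dimension A
  ... | d , dA with r A ℕₚ.≟ d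
  ...   | yes rA≡d = yes (subst (IsDim A) (sym rA≡d) dA)
  ...   | no  rA≢d = no λ indA → rA≢d (dim-unique {A} indA dA)

  dependent⇒rank<dim : ∀ {C d} → Dependent C → IsDim C d → r C < d
  dependent⇒rank<dim {C} {d} dep dC with m≤n⇒m<n∨m≡n (R1 C d dC)
  ... | inj₁ rC<d  = rC<d
  ... | inj₂ rC≡d = ⊥-elim (dep (subst (IsDim C) (sym rC≡d) dC))

  independent-hereditary : ∀ {J I} → J ⊆ I → Independent I → Independent J
  independent-hereditary {J} {I} J⊆I indI with dimension J
  ... | j , dJ@(μ , μ∈J , indμ , J⊆μ) with extend-to-basis {I} (VAll.map (J⊆I _) μ∈J) indμ
  ... | m , ρ , basisI@(_ , _ , I⊆ρμ) = subst (IsDim J) (sym rJ≡j) dJ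
    where
    m+j≤m+rJ : m + j ≤ m + r J
    m+j≤m+rJ = begin
      m + j                   ≡⟨ dim-unique {I} indI (ρ ++ μ , basisI) ⟨
      r I                     ≤⟨ R2 I _ (λ v v∈I → span-++ ρ μ v (I⊆ρμ v v∈I)) ⟩
      r (span ρ ⊞ span μ)     ≤⟨ rank-subadditive _ _ ⟩
      r (span ρ) + r (span μ) ≤⟨ +-mono-≤ (rank-span≤ ρ) (≤-reflexive (rank-cong (span-⊆ J μ∈J) J⊆μ)) ⟩
      m + r J                 ∎
    rJ≡j : r J ≡ j
    rJ≡j = ≤-antisym (R1 J j dJ) (+-cancelˡ-≤ m _ _ m+j≤m+rJ)

  rank-saturated : ∀ {k} (β : Vec V k) (X : Subspace) →
    (∀ v → mem X v → r (span (v ∷ β)) ≡ r (span β)) →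
    ∀ {g} (γ : Vec V g) → VAll (mem X) γ → r (span (γ ++ β)) ≡ r (span β)
  rank-saturated β X saturated []      []           = refl
  rank-saturated β X saturated (v ∷ γ) (v∈X ∷ γ∈X) = ≤-antisym upper lower
    where
    Y = span (γ ++ β)
    Z = span (v ∷ β)
    rY≡rβ : r Y ≡ r (span β)
    rY≡rβ = rank-saturated β X saturated γ γ∈X
    vγβ⊆Z⊞Y : span (v ∷ γ ++ β) ⊆ Z ⊞ Y
    vγβ⊆Z⊞Y w w∈ =
      ⊞-mono {span (v ∷ [])} {Z} {Y} {Y} (span-⊆ Z (VAll.head (span-generators (v ∷ β)) ∷ [])) (λ _ → id) w
        (span-++ (v ∷ []) (γ ++ β) w w∈)
    β⊆Z⊓Y : span β ⊆ Z ⊓ Y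
    β⊆Z⊓Y w w∈β = span-⊆-∷ v β w w∈β , span-⊆-++ʳ γ β w w∈β
    upper : r (span (v ∷ γ ++ β)) ≤ r (span β)
    upper = +-cancelʳ-≤ (r (span β)) _ _ (begin
      r (span (v ∷ γ ++ β)) + r (span β) ≤⟨ +-mono-≤ (R2 _ _ vγβ⊆Z⊞Y) (R2 _ _ β⊆Z⊓Y) ⟩
      r (Z ⊞ Y) + r (Z ⊓ Y)              ≤⟨ rank-submodular Z Y ⟩
      r Z + r Y                          ≡⟨ cong₂ _+_ (saturated v v∈X) rY≡rβ ⟩
      r (span β) + r (span β)            ∎)
    lower : r (span β) ≤ r (span (v ∷ γ ++ β))
    lower = subst (_≤ r (span (v ∷ γ ++ β))) rY≡rβ (R2 _ _ (span-⊆-∷ v (γ ++ β)))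

  IsRankBasis : Subspace → ∀ {j} → Vec V j → Set
  IsRankBasis X {j} β = VAll (mem X) β × LinearlyIndependent β × r (span β) ≡ j × r X ≡ j

  -- Greedily add vectors of X that raise the rank; once none does, rank-saturated gives r X.
  rank-basis : ∀ X → Σ ℕ λ j → Σ (Vec V j) (IsRankBasis X)
  rank-basis X =
    bounded-extension n Candidate (λ (_ , ind , _) → independent⇒length≤n ind) grow
      ([] , (λ { [] _ → refl }) , n≤0⇒n≡0 (rank-span≤ []))
    where
    Candidate : ∀ {k} → Vec V k → Set
    Candidate {k} β = VAll (mem X) β × LinearlyIndependent β × r (span β) ≡ k
    grow : ∀ {k} {β : Vec V k} → Candidate β →
           (Σ ℕ λ j → Σ (Vec V j) (IsRankBasis X)) ⊎ Σ V λ v → Candidate (v ∷ β)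
    grow {k} {β} (β∈X , ind , rβ≡k)
      with finite-any? (vectors-finite n) (λ v → dec X v ×-dec (r (span (v ∷ β)) ℕₚ.≟ suc k))
    ... | yes (v , v∈X , rvβ≡1+k) = inj₂ (v , v∈X ∷ β∈X , independent-∷ ind v∉β , rvβ≡1+k)
      where
      v∉β : ¬ InSpan β v
      v∉β v∈β = ℕₚ.1+n≢n (begin-equality
        suc k             ≡⟨ rvβ≡1+k ⟨
        r (span (v ∷ β))  ≡⟨ rank-cong (span-∷-absorb v∈β) (span-⊆-∷ v β) ⟩
        r (span β)        ≡⟨ rβ≡k ⟩
        k                 ∎)
    ... | no ¬growth = inj₁ (k , β , β∈X , ind , rβ≡k , trans rX≡rβ rβ≡k)
      where
      saturated : ∀ v → mem X v → r (span (v ∷ β)) ≡ r (span β)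
      saturated v v∈X = ≤-antisym (subst (r (span (v ∷ β)) ≤_) (sym rβ≡k) rvβ≤k) (R2 _ _ (span-⊆-∷ v β))
        where
        rvβ≤k : r (span (v ∷ β)) ≤ k
        rvβ≤k = ≤-pred (≤∧≢⇒< (subst (λ t → r (span (v ∷ β)) ≤ suc t) rβ≡k (rank-∷≤ v β))
                                λ eq → ¬growth (v , v∈X , eq))
      rX≡rβ : r X ≡ r (span β)
      rX≡rβ with dimension X
      ... | _ , γ , γ∈X , _ , X⊆γ = trans
        (rank-cong (λ v v∈X → span-⊆-++ˡ γ β v (X⊆γ v v∈X)) (span-⊆ X (VAll.++⁺ γ∈X β∈X)))
        (rank-saturated β X saturated γ γ∈X)

  dependent-contains-circuit : ∀ Z → Dependent Z → Σ Subspace λ C → Circuit C × C ⊆ Z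
  dependent-contains-circuit Z = <-rec Goal descend _ Z (proj₂ (dimension Z))
    where
    Goal : ℕ → Set₁
    Goal d = ∀ Z → IsDim Z d → Dependent Z → Σ Subspace λ C → Circuit C × C ⊆ Z
    -- Either some e < d vectors of Z span a dependent subspace, into which we descend,
    -- or every proper subspace of Z is independent.
    descend : ∀ d → (∀ {e} → e < d → Goal e) → Goal d
    descend d smaller Z dZ dep
      with anyUpTo? (λ e → finite-any? (vec-finite e (vectors-finite n))
                             (λ L → VAll.all? (dec Z) L ×-dec ¬? (independent? (span L)))) d
    ... | yes (e , e<d , L , L∈Z , depL) with dimension (span L)
    ...   | _ , dL@(_ , basis∈L , ind , _)
      with smaller (≤-<-trans (independent⇒length≤spanning L ind basis∈L) e<d) (span L) dL depL
    ...     | C , circuit , C⊆L = C , circuit , λ v v∈C → span-⊆ Z L∈Z v (C⊆L v v∈C)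
    descend d smaller Z dZ dep | no noDependentSpan = Z , (dep , properIndependent) , λ _ → id
      where
      properIndependent : ∀ W → W ⊆ Z → ¬ (Z ⊆ W) → Independent W
      properIndependent W W⊆Z Z⊈W with dimension W
      ... | w , dW@(ω , ω∈W , _ , W⊆ω) =
        independent-cong (span-⊆ W ω∈W) W⊆ω (decidable-stable (independent? (span ω)) λ depω →
          noDependentSpan (w , proper-subspace-dim< {W} {Z} W⊆Z Z⊈W dZ dW , ω , VAll.map (W⊆Z _) ω∈W , depω))

module OpenSpaces {F : FiniteField} {n : ℕ} (M : QMatroid F n) where
  open FiniteField F
  open LinAlg F n
  open Coordinates F
  open Linear F n
  open QMatroid M
  open QMatroidNotions M
  open Rank M
  open ≤-Reasoning

  sumOf : List Subspace → Subspace
  sumOf []       = span []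
  sumOf (C ∷ Cs) = C ⊞ sumOf Cs

  sumOf⇒InListSum : ∀ Cs {v} → mem (sumOf Cs) v → InListSum Cs v
  sumOf⇒InListSum []       ([] , eq)                   = sym eq
  sumOf⇒InListSum (C ∷ Cs) (c , w , c∈C , w∈Cs , eq) = c , w , c∈C , sumOf⇒InListSum Cs w∈Cs , eq

  InListSum⇒sumOf : ∀ Cs {v} → InListSum Cs v → mem (sumOf Cs) v
  InListSum⇒sumOf []       refl                        = [] , refl
  InListSum⇒sumOf (C ∷ Cs) (c , w , c∈C , w∈Cs , eq) = c , w , c∈C , InListSum⇒sumOf Cs w∈Cs , eq

  sumOf-⊆ : ∀ {A} Cs → LAll (_⊆ A) Cs → sumOf Cs ⊆ A
  sumOf-⊆ {A} []       []           = span-⊆ A []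
  sumOf-⊆ {A} (C ∷ Cs) (C⊆A ∷ Cs⊆A) = ⊞-⊆ {C} {sumOf Cs} {A} C⊆A (sumOf-⊆ {A} Cs Cs⊆A)

  summands-⊆ : ∀ Cs → LAll (_⊆ sumOf Cs) Cs
  summands-⊆ []       = []
  summands-⊆ (C ∷ Cs) =
    ⊆-⊞ˡ {C} {sumOf Cs}
    ∷ LAll.map (λ C′⊆Cs v v∈C′ → ⊆-⊞ʳ {C} {sumOf Cs} v (C′⊆Cs v v∈C′)) (summands-⊆ Cs)

  sumOf-⊆-or-escapes : ∀ {p} {P : Subspace → Set p} (B : Subspace) Cs → LAll P Cs →
    sumOf Cs ⊆ B ⊎ Σ Subspace λ C → P C × Σ V λ x → mem C x × ¬ mem B x
  sumOf-⊆-or-escapes B []       []         = inj₁ (span-⊆ B [])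
  sumOf-⊆-or-escapes B (C ∷ Cs) (pC ∷ pCs) with ⊆-or-witness C B | sumOf-⊆-or-escapes B Cs pCs
  ... | inj₂ x-escapes | _                    = inj₂ (C , pC , x-escapes)
  ... | inj₁ _         | inj₂ escaping        = inj₂ escaping
  ... | inj₁ C⊆B       | inj₁ Cs⊆B            = inj₁ (⊞-⊆ {C} {sumOf Cs} {B} C⊆B Cs⊆B)

  hyperplane-rank : ∀ {H A C x} → IsHyperplane H A → Circuit C → C ⊆ A → mem C x → ¬ mem H x →
    r A ≤ r H
  hyperplane-rank {H} {A} {C} {x} hyp (depC , properIndependent) C⊆A x∈C x∉H
    with dimension (C ⊓ H) | dimension C
  ... | j , dC⊓H@(μ , _ , _ , C⊓H⊆μ) | d , dC@(γ , γ∈C , indγ , _) =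
    +-cancelʳ-≤ (r (C ⊓ H)) _ _ (begin
      r A + r (C ⊓ H)       ≤⟨ +-monoˡ-≤ _ (R2 _ _ A⊆C⊞H) ⟩
      r (C ⊞ H) + r (C ⊓ H) ≤⟨ rank-submodular C H ⟩
      r C + r H             ≤⟨ +-monoˡ-≤ _ rC≤rC⊓H ⟩
      r (C ⊓ H) + r H       ≡⟨ ℕₚ.+-comm (r (C ⊓ H)) (r H) ⟩
      r H + r (C ⊓ H)       ∎)
    where
    x⊆C : span (x ∷ []) ⊆ C
    x⊆C = span-⊆ C (x∈C ∷ [])
    A⊆x⊞H : A ⊆ span (x ∷ []) ⊞ H
    A⊆x⊞H = hyperplane-⊞ {H} {A} hyp (C⊆A x x∈C) x∉H
    A⊆C⊞H : A ⊆ C ⊞ H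
    A⊆C⊞H v v∈A = ⊞-mono {span (x ∷ [])} {C} {H} {H} x⊆C (λ _ → id) v (A⊆x⊞H v v∈A)
    C⊆xμ : C ⊆ span (x ∷ μ)
    C⊆xμ v v∈C =
      ⊞-⊆ {span (x ∷ [])} {span μ} {span (x ∷ μ)} (span-⊆-++ˡ (x ∷ []) μ) (span-⊆-++ʳ (x ∷ []) μ) v
        (⊞-mono {span (x ∷ [])} {span (x ∷ [])} {C ⊓ H} {span μ} (λ _ → id) C⊓H⊆μ v
          (modular {span (x ∷ [])} {H} {C} x⊆C v (v∈C , A⊆x⊞H v (C⊆A v v∈C))))
    C⊓H-independent : Independent (C ⊓ H)
    C⊓H-independent = properIndependent (C ⊓ H) (λ _ → proj₁) (λ C⊆C⊓H → x∉H (proj₂ (C⊆C⊓H x x∈C)))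
    d≤1+j : d ≤ suc j
    d≤1+j = independent⇒length≤spanning (x ∷ μ) indγ (VAll.map (C⊆xμ _) γ∈C)
    rC≤rC⊓H : r C ≤ r (C ⊓ H)
    rC≤rC⊓H = subst (r C ≤_) (sym (dim-unique {C ⊓ H} C⊓H-independent dC⊓H))
                    (≤-pred (<-≤-trans (dependent⇒rank<dim {C} depC dC) d≤1+j))

  open-space-summands : ∀ {A} → ((Cs , _ , _) : OpenSpace A) → LAll (λ C → Circuit C × C ⊆ A) Cs
  open-space-summands {A} (Cs , circuits , A⇔Cs) =
    LAll.zip (circuits , LAll.map (λ {C} → C⊆A {C}) (summands-⊆ Cs))
    where
    C⊆A : ∀ {C} → C ⊆ sumOf Cs → C ⊆ A
    C⊆A C⊆Cs v v∈C = Equivalence.from (A⇔Cs v) (sumOf⇒InListSum Cs (C⊆Cs v v∈C))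

  open⇒cyclic : ∀ {A} → OpenSpace A → Cyclic A
  open⇒cyclic {A} openA@(Cs , _ , A⇔Cs) H k H⊆A dA@(_ , α∈A , indα , _) dH
    with sumOf-⊆-or-escapes H Cs (open-space-summands {A} openA)
  ... | inj₁ Cs⊆H = ⊥-elim (<-irrefl refl (independent⇒length≤dim {H} dH (VAll.map (A⊆H _) α∈A) indα))
    where
    A⊆H : A ⊆ H
    A⊆H v v∈A = Cs⊆H v (InListSum⇒sumOf Cs (Equivalence.to (A⇔Cs v) v∈A))
  ... | inj₂ (C , (circuit , C⊆A) , x , x∈C , x∉H) =
    ≤-antisym (R2 H A H⊆A) (hyperplane-rank (H⊆A , k , dA , dH) circuit C⊆A x∈C x∉H)

  circuit-escaping : ∀ {H A x} → H ⊆ A → mem A x → ¬ mem H x → r H ≡ r A →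
    Σ Subspace λ C → Circuit C × C ⊆ A × Σ V λ y → mem C y × ¬ mem H y
  circuit-escaping {H} {A} {x} H⊆A x∈A x∉H rH≡rA with rank-basis H
  ... | j , β , β∈H , indβ , rβ≡j , rH≡j =
    escape (dependent-contains-circuit (span (x ∷ β)) xβ-dependent)
    where
    xβ⊆A : span (x ∷ β) ⊆ A
    xβ⊆A = span-⊆ A (x∈A ∷ VAll.map (H⊆A _) β∈H)
    xβ-dependent : Dependent (span (x ∷ β))
    xβ-dependent xβ-independent = <-irrefl refl (begin
      suc j            ≡⟨ dim-unique {span (x ∷ β)} xβ-independent (x ∷ β , span-basis indxβ) ⟨
      r (span (x ∷ β)) ≤⟨ R2 _ _ xβ⊆A ⟩
      r A              ≡⟨ trans (sym rH≡rA) rH≡j ⟩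
      j                ∎)
      where
      indxβ : LinearlyIndependent (x ∷ β)
      indxβ = independent-∷ indβ (x∉H ∘ span-⊆ H β∈H _)
    escape : (Σ Subspace λ C → Circuit C × C ⊆ span (x ∷ β)) →
             Σ Subspace λ C → Circuit C × C ⊆ A × Σ V λ y → mem C y × ¬ mem H y
    escape (C , circuit , C⊆xβ) with ⊆-or-witness C H
    ... | inj₂ y-escapes = C , circuit , (λ v v∈C → xβ⊆A v (C⊆xβ v v∈C)) , y-escapes
    ... | inj₁ C⊆H       = ⊥-elim (proj₁ circuit (independent-hereditary C⊆β β-independent))
      where
      C⊆β : C ⊆ span β
      C⊆β v v∈C = span-∷-⊓ {H} {x} β∈H x∉H v (C⊆H v v∈C , C⊆xβ v v∈C)
      β-independent : Independent (span β)
      β-independent = subst (IsDim (span β)) (sym rβ≡j) (β , span-basis indβ)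

  cyclic-circuit-escaping : ∀ {A T x} → Cyclic A → T ⊆ A → mem A x → ¬ mem T x →
    Σ Subspace λ C → Circuit C × C ⊆ A × Σ V λ y → mem C y × ¬ mem T y
  cyclic-circuit-escaping {A} {T} {x} cyclic T⊆A x∈A x∉T =
    let H , (H⊆A , d , dA , dH) , T⊆H , x∉H = hyperplane-avoiding {T} {A} {x} T⊆A x∈A x∉T
        C , circuit , C⊆A , y , y∈C , y∉H = circuit-escaping {H} {A} {x} H⊆A x∈A x∉H (cyclic H d H⊆A dA dH)
    in C , circuit , C⊆A , y , y∈C , y∉H ∘ T⊆H y

  cyclic⇒open : ∀ {A} → Cyclic A → OpenSpace A
  cyclic⇒open {A} cyclic =
    bounded-extension n Progress (λ (_ , _ , _ , ind) → independent⇒length≤n ind) grow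
      ([] , [] , [] , λ { [] _ → refl })
    where
    Progress : ∀ {k} → Vec V k → Set₁
    Progress τ = Σ (List Subspace) λ Cs →
      LAll (λ C → Circuit C × C ⊆ A) Cs × VAll (mem (sumOf Cs)) τ × LinearlyIndependent τ
    grow : ∀ {k} {τ : Vec V k} → Progress τ → OpenSpace A ⊎ Σ V λ y → Progress (y ∷ τ)
    grow (Cs , valid , τ∈Cs , indτ) with ⊆-or-witness A (sumOf Cs)
    ... | inj₁ A⊆Cs = inj₁ (Cs , LAll.map proj₁ valid , λ v →
      mk⇔ (sumOf⇒InListSum Cs ∘ A⊆Cs v) (sumOf-⊆ {A} Cs (LAll.map proj₂ valid) v ∘ InListSum⇒sumOf Cs))
    ... | inj₂ (x , x∈A , x∉Cs) =
      let C , circuit , C⊆A , y , y∈C , y∉Cs =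
            cyclic-circuit-escaping {A} {sumOf Cs} cyclic (sumOf-⊆ {A} Cs (LAll.map proj₂ valid)) x∈A x∉Cs
      in inj₂ (y , C ∷ Cs , (circuit , C⊆A) ∷ valid ,
               ⊆-⊞ˡ {C} {sumOf Cs} y y∈C ∷ VAll.map (⊆-⊞ʳ {C} {sumOf Cs} _) τ∈Cs ,
               independent-∷ indτ (y∉Cs ∘ span-⊆ (sumOf Cs) τ∈Cs y))

  InListSum⇒InSumOfCircuitsIn : ∀ {A} Cs → LAll (λ C → Circuit C × C ⊆ A) Cs →
    ∀ {v} → InListSum Cs v → InSumOfCircuitsIn A v
  InListSum⇒InSumOfCircuitsIn []       []                      refl = [] , refl
  InListSum⇒InSumOfCircuitsIn (C ∷ Cs) ((circuit , C⊆A) ∷ valid) (c , w , c∈C , w∈Cs , eq)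
    with InListSum⇒InSumOfCircuitsIn Cs valid w∈Cs
  ... | cs , sum≡w = (C , circuit , C⊆A , c , c∈C) ∷ cs , trans (cong (c ⊕_) sum≡w) (sym eq)

  -- The partial sum of the tail, local to InSumOfCircuitsIn, is named by unification via refl.
  InSumOfCircuitsIn⇒∈ : ∀ {A v} → InSumOfCircuitsIn A v → mem A v
  InSumOfCircuitsIn⇒∈ {A} ([] , eq) = subst (mem A) eq (0∈ A)
  InSumOfCircuitsIn⇒∈ {A} ((C , _ , C⊆A , c , c∈C) ∷ cs , eq) =
    subst (mem A) eq (+∈ A (C⊆A c c∈C) (InSumOfCircuitsIn⇒∈ (cs , refl)))

  open⇒sum-of-circuits : ∀ {A} → OpenSpace A → ∀ v → mem A v ⇔ InSumOfCircuitsIn A v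
  open⇒sum-of-circuits {A} openA@(Cs , _ , A⇔Cs) v =
    mk⇔ (InListSum⇒InSumOfCircuitsIn Cs (open-space-summands {A} openA) ∘ Equivalence.to (A⇔Cs v))
        InSumOfCircuitsIn⇒∈

corollary2p15 : (F : FiniteField) (n : ℕ) (M : QMatroid F n) (A : LinAlg.Subspace F n) →
    let open LinAlg F n
        open QMatroidNotions M
    in (Cyclic A ⇔ OpenSpace A)
       × (Cyclic A → ∀ v → mem A v ⇔ InSumOfCircuitsIn A v)
corollary2p15 F n M A = mk⇔ cyclic⇒open open⇒cyclic , open⇒sum-of-circuits ∘ cyclic⇒open
  where open OpenSpaces M
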